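{- $\mathrm{EqFSCL}\vdash (x\vee y)\wedge(z\wedge\mathsf F)=(\neg x\vee(z\wedge\mathsf F))\wedge(y\wedge(z\wedge\mathsf F))$.
   Context: Terms are over the signature with constants $\mathsf T,\mathsf F$ (and atoms), unary $\neg$ and binary $\wedge,\vee$ (left-sequential conjunction and disjunction), with variables $x,y,z,\dots$. $\mathrm{EqFSCL}\vdash s=t$ means $s=t$ is derivable in equational logic from the axioms: (F1) $\mathsf F=\neg\mathsf T$; (F2) $x\vee y=\neg(\neg x\wedge\neg y)$; (F3) $\neg\neg x=x$; (F4) $\mathsf T\wedge x=x$; (F5) $x\vee\mathsf F=x$; (F6) $\mathsf F\wedge x=\mathsf F$; (F7) $(x\wedge y)\wedge z=x\wedge(y\wedge z)$; (F8) $\neg x\wedge\mathsf F=x\wedge\mathsf F$; (F9) $(x\wedge\mathsf F)\vee y=(x\vee\mathsf T)\wedge y$; (F10) $(x\wedge y)\vee(z\wedge\mathsf F)=(x\vee(z\wedge\mathsf F))\wedge(y\vee(z\wedge\mathsf F))$. -}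

module Defs where

open import Data.Nat using (ℕ)

data Term (A : Set) : Set where
  var  : ℕ → Term A
  atom : A → Term A
  T F  : Term A
  ¬_   : Term A → Term A
  _∧_ _∨_ : Term A → Term A → Term A

infix  9 ¬_
infixr 7 _∧_
infixr 6 _∨_

infix 4 EqFSCL⊢_≈_
data EqFSCL⊢_≈_ {A : Set} : Term A → Term A → Set where
  F1  : EqFSCL⊢ F ≈ ¬ T
  F2  : ∀ x y → EqFSCL⊢ x ∨ y ≈ ¬ (¬ x ∧ ¬ y)
  F3  : ∀ x → EqFSCL⊢ ¬ ¬ x ≈ x
  F4  : ∀ x → EqFSCL⊢ T ∧ x ≈ x
  F5  : ∀ x → EqFSCL⊢ x ∨ F ≈ x
  F6  : ∀ x → EqFSCL⊢ F ∧ x ≈ F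
  F7  : ∀ x y z → EqFSCL⊢ (x ∧ y) ∧ z ≈ x ∧ (y ∧ z)
  F8  : ∀ x → EqFSCL⊢ ¬ x ∧ F ≈ x ∧ F
  F9  : ∀ x y → EqFSCL⊢ (x ∧ F) ∨ y ≈ (x ∨ T) ∧ y
  F10 : ∀ x y z → EqFSCL⊢ (x ∧ y) ∨ (z ∧ F) ≈ (x ∨ (z ∧ F)) ∧ (y ∨ (z ∧ F))
  refl  : ∀ {s} → EqFSCL⊢ s ≈ s
  sym   : ∀ {s t} → EqFSCL⊢ s ≈ t → EqFSCL⊢ t ≈ s
  trans : ∀ {s t u} → EqFSCL⊢ s ≈ t → EqFSCL⊢ t ≈ u → EqFSCL⊢ s ≈ u
  cong¬ : ∀ {s t} → EqFSCL⊢ s ≈ t → EqFSCL⊢ ¬ s ≈ ¬ t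
  cong∧ : ∀ {s s' t t'} → EqFSCL⊢ s ≈ s' → EqFSCL⊢ t ≈ t' → EqFSCL⊢ s ∧ t ≈ s' ∧ t'
  cong∨ : ∀ {s s' t t'} → EqFSCL⊢ s ≈ s' → EqFSCL⊢ t ≈ t' → EqFSCL⊢ s ∨ t ≈ s' ∨ t'

-- A term followed by ∧ F only contributes its side effects, and by F8 these
-- are the same for s and ¬ s. Writing z ∧ F as (z ∨ T) ∧ F moves the final F
-- outermost, so (x ∨ y) ∧ (z ∨ T) may be replaced by its negation
-- (¬ x ∧ ¬ y) ∨ (z ∧ F); F10 then distributes this over ∧, and a second
-- negation under F turns the factor ¬ y ∨ (z ∧ F) back into y.
module Submission where

open import Relation.Binary.Bundles using (Setoid)
import Relation.Binary.Reasoning.Setoid as SetoidReasoning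

open import Defs

module _ {A : Set} where

  setoid : Setoid _ _
  setoid = record
    { Carrier       = Term A
    ; _≈_           = EqFSCL⊢_≈_
    ; isEquivalence = record { refl = refl ; sym = sym ; trans = trans }
    }

  open SetoidReasoning setoid

  ¬-∨ : (a b : Term A) → EqFSCL⊢ ¬ (a ∨ b) ≈ ¬ a ∧ ¬ b
  ¬-∨ a b = trans (cong¬ (F2 a b)) (F3 _)

  ¬-∧ : (a b : Term A) → EqFSCL⊢ ¬ (a ∧ b) ≈ ¬ a ∨ ¬ b
  ¬-∧ a b = begin
    ¬ (a ∧ b)          ≈⟨ cong¬ (cong∧ (sym (F3 a)) (sym (F3 b))) ⟩
    ¬ (¬ ¬ a ∧ ¬ ¬ b)  ≈⟨ sym (F2 (¬ a) (¬ b)) ⟩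
    ¬ a ∨ ¬ b          ∎

  ∧F≈∨T∧F : (a : Term A) → EqFSCL⊢ a ∧ F ≈ (a ∨ T) ∧ F
  ∧F≈∨T∧F a = begin
    a ∧ F              ≈⟨ sym (F5 _) ⟩
    (a ∧ F) ∨ F        ≈⟨ F9 a F ⟩
    (a ∨ T) ∧ F        ∎

  ¬[∨T]≈∧F : (a : Term A) → EqFSCL⊢ ¬ (a ∨ T) ≈ a ∧ F
  ¬[∨T]≈∧F a = begin
    ¬ (a ∨ T)          ≈⟨ ¬-∨ a T ⟩
    ¬ a ∧ ¬ T          ≈⟨ cong∧ refl (sym F1) ⟩
    ¬ a ∧ F            ≈⟨ F8 a ⟩
    a ∧ F              ∎

  ¬[∧F]∧F≈∧F : (a : Term A) → EqFSCL⊢ ¬ (a ∧ F) ∧ F ≈ a ∧ F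
  ¬[∧F]∧F≈∧F a = begin
    ¬ (a ∧ F) ∧ F      ≈⟨ F8 (a ∧ F) ⟩
    (a ∧ F) ∧ F        ≈⟨ F7 a F F ⟩
    a ∧ (F ∧ F)        ≈⟨ cong∧ refl (F6 F) ⟩
    a ∧ F              ∎

  ¬∨∧F-∧F : (a b : Term A) → EqFSCL⊢ (¬ a ∨ (b ∧ F)) ∧ F ≈ a ∧ (b ∧ F)
  ¬∨∧F-∧F a b = begin
    (¬ a ∨ (b ∧ F)) ∧ F          ≈⟨ sym (F8 _) ⟩
    ¬ (¬ a ∨ (b ∧ F)) ∧ F        ≈⟨ cong∧ (¬-∨ (¬ a) (b ∧ F)) refl ⟩
    (¬ ¬ a ∧ ¬ (b ∧ F)) ∧ F      ≈⟨ cong∧ (cong∧ (F3 a) refl) refl ⟩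
    (a ∧ ¬ (b ∧ F)) ∧ F          ≈⟨ F7 _ _ _ ⟩
    a ∧ (¬ (b ∧ F) ∧ F)          ≈⟨ cong∧ refl (¬[∧F]∧F≈∧F b) ⟩
    a ∧ (b ∧ F)                  ∎

  ∧[∨T]∧F-negate : (a b : Term A) →
    EqFSCL⊢ (a ∧ (b ∨ T)) ∧ F ≈ (¬ a ∨ (b ∧ F)) ∧ F
  ∧[∨T]∧F-negate a b = begin
    (a ∧ (b ∨ T)) ∧ F            ≈⟨ sym (F8 _) ⟩
    ¬ (a ∧ (b ∨ T)) ∧ F          ≈⟨ cong∧ (¬-∧ a (b ∨ T)) refl ⟩
    (¬ a ∨ ¬ (b ∨ T)) ∧ F        ≈⟨ cong∧ (cong∨ refl (¬[∨T]≈∧F b)) refl ⟩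
    (¬ a ∨ (b ∧ F)) ∧ F          ∎

lemma2p6 : {A : Set} → (x y z : Term A) →
    EqFSCL⊢ (x ∨ y) ∧ (z ∧ F) ≈ (¬ x ∨ (z ∧ F)) ∧ (y ∧ (z ∧ F))
lemma2p6 x y z = begin
  (x ∨ y) ∧ (z ∧ F)                          ≈⟨ cong∧ refl (∧F≈∨T∧F z) ⟩
  (x ∨ y) ∧ ((z ∨ T) ∧ F)                    ≈⟨ sym (F7 _ _ _) ⟩
  ((x ∨ y) ∧ (z ∨ T)) ∧ F                    ≈⟨ ∧[∨T]∧F-negate (x ∨ y) z ⟩
  (¬ (x ∨ y) ∨ (z ∧ F)) ∧ F                  ≈⟨ cong∧ (cong∨ (¬-∨ x y) refl) refl ⟩
  ((¬ x ∧ ¬ y) ∨ (z ∧ F)) ∧ F                ≈⟨ cong∧ (F10 _ _ _) refl ⟩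
  ((¬ x ∨ (z ∧ F)) ∧ (¬ y ∨ (z ∧ F))) ∧ F    ≈⟨ F7 _ _ _ ⟩
  (¬ x ∨ (z ∧ F)) ∧ ((¬ y ∨ (z ∧ F)) ∧ F)    ≈⟨ cong∧ refl (¬∨∧F-∧F y z) ⟩
  (¬ x ∨ (z ∧ F)) ∧ (y ∧ (z ∧ F))            ∎
  where open SetoidReasoning setoid
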